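{- Let $r,t,f$ be nonnegative integers with $r-t\geq0$. Then \[\widetilde s_{(r)/(t),(f)}(z|\mathbf b)=e^{[f|r-t-f-1]}_{r-t}(z|\tau^{ -t}b).\] In particular, if $r-t>f$, both sides are zero.
   Context: $\mathbf b=(b_i)_{i\in\mathbb Z}$ are independent indeterminates, and $\tau^{k}b=(b_{1+k},b_{2+k},\dots)$. For an integer $k$ and a sequence $y=(y_1,y_2,\dots)$, $e^{[k]}_u(y)=\prod_{i=1}^k(1+y_iu)$ for $k\geq0$ and $\prod_{i=1}^{|k|}(1-y_iu)^{ -1}$ for $k\leq0$; $e^{[k|\ell]}_m(z|y)$ is the coefficient of $u^m$ in $e^{[k]}_u(z)e^{[\ell]}_u(y)$ (zero if $m<0$). $\widetilde s_{(r)/(t),(f)}(z|\mathbf b)=\sum_T\prod_{e\in T}(z_{|e|}+b_{|e|+r(e)-c(e)})$, summed over fillings $T$ of the boxes in columns $t+1,\dots,r$ of a single row (row index $r(e)=1$, column index $c(e)$) by positive integers strictly increasing left to right and at most $f$; $|e|$ is the value of the entry. -}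

module Defs where

open import Level using (Level)
open import Algebra.Bundles using (CommutativeRing)
open import Data.Nat as ℕ using (ℕ; zero; suc; _∸_)
open import Data.Integer as ℤ using (ℤ; +_; -[1+_])
open import Data.List using (List; []; _∷_; map; concatMap; foldr; upTo)

rangeAbove : ℕ → ℕ → List ℕ
rangeAbove lo f = map (λ i → suc (lo ℕ.+ i)) (upTo (f ∸ lo))

incSeqs : ℕ → ℕ → ℕ → List (List ℕ)
incSeqs zero    lo f = [] ∷ []
incSeqs (suc n) lo f = concatMap (λ v → map (v ∷_) (incSeqs n v f)) (rangeAbove lo f)


-- Ring-valued power series in one variable u: coefficient functions.
module _ {c ℓ : Level} (R : CommutativeRing c ℓ) where
  open CommutativeRing R

  Series : Set c
  Series = ℕ → Carrier

  sumBelow : (ℕ → Carrier) → ℕ → Carrier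
  sumBelow g zero    = 0#
  sumBelow g (suc n) = sumBelow g n + g n

  _⊛_ : Series → Series → Series
  (s ⊛ t) n = sumBelow (λ i → s i * t (n ∸ i)) (suc n)

  oneS : Series
  oneS zero    = 1#
  oneS (suc _) = 0#

  linS : Carrier → Series
  linS y zero          = 1#
  linS y (suc zero)    = y
  linS y (suc (suc _)) = 0#

  pow : Carrier → ℕ → Carrier
  pow y zero    = 1#
  pow y (suc n) = y * pow y n

  -- (1 - y u)^{-1} = Σ_n y^n u^n
  geomS : Carrier → Series
  geomS y n = pow y n

  -- ∏_{i=1}^{k} F(y_i)  (sequences y = (y_1, y_2, ...) are functions ℕ → R, y i = y_i; y 0 unused)
  prodS : (Carrier → Series) → (ℕ → Carrier) → ℕ → Series
  prodS F y zero    = oneS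
  prodS F y (suc k) = prodS F y k ⊛ F (y (suc k))

  eGen : ℤ → (ℕ → Carrier) → Series
  eGen (+ k)     y = prodS linS y k
  eGen -[1+ k ]  y = prodS geomS y (suc k)

  eKL : ℤ → ℤ → (ℕ → Carrier) → (ℕ → Carrier) → ℕ → Carrier
  eKL k l z y m = (eGen k z ⊛ eGen l y) m

  shiftSeq : (ℤ → Carrier) → ℕ → ℕ → Carrier
  shiftSeq b t i = b ((+ i) ℤ.- (+ t))

  -- weight of a filling of consecutive boxes of row 1 starting at column col:
  -- ∏_e (z_{|e|} + b_{|e| + r(e) - c(e)}) with r(e) = 1
  fillWeight : (ℕ → Carrier) → (ℤ → Carrier) → ℕ → List ℕ → Carrier
  fillWeight z b col []       = 1#
  fillWeight z b col (v ∷ vs) =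
    (z v + b ((+ v) ℤ.+ (+ 1) ℤ.- (+ col))) * fillWeight z b (suc col) vs

  sumL : List Carrier → Carrier
  sumL = foldr _+_ 0#


  -- \tilde s_{(r)/(t),(f)}(z|b): sum over fillings T of boxes in columns t+1..r of row 1
  -- with entries in {1..f} strictly increasing left to right
  stilde : (ℕ → Carrier) → (ℤ → Carrier) → ℕ → ℕ → ℕ → Carrier
  stilde z b r t f = sumL (map (fillWeight z b (suc t)) (incSeqs (r ∸ t) 0 f))

-- Removing the largest admissible entry f + 1 splits the fillings into those avoiding it and those
-- ending in it (at column t + n + 1), giving the recurrence
--   s̃(f + 1, n + 1) = s̃(f, n + 1) + (z_{f+1} + b_{f+1-n-t}) s̃(f, n).
-- With y_i = b_{i-t}, the coefficients of ∏_{i ≤ f} (1 + z_i u) ∏_{i ≤ f-n+1} (1 - y_i u)⁻¹ obey the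
-- same recurrence: multiplying by 1 + z_{f+1} u contributes the z-term, and peeling off
-- (1 - y_{f+1-n} u)⁻¹ the b-term.
-- When n > f there is no filling, and the right-hand side is the u^n-coefficient of a polynomial of
-- degree n - 1.
module Submission where

open import Defs
open import Level using (Level)
open import Algebra.Bundles using (CommutativeRing)
open import Data.Nat as ℕ using (ℕ; zero; suc; _≤_; _<_; _∸_; _≤?_; z≤n; s≤s)
open import Data.Nat.Properties as ℕP using (n∸n≡0; +-∸-assoc; m+[n∸m]≡n)
open import Data.Integer as ℤ using (ℤ; +_; -[1+_]; _-_)
open import Data.Integer.Properties using (pos-+)
open import Data.Integer.Solver using (module +-*-Solver)
open import Data.List using (List; []; _∷_; map; concatMap; upTo; _++_)
import Data.List.Properties as List
open import Data.List.Membership.Propositional using (_∈_)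
open import Data.List.Membership.Propositional.Properties using (∈-map⁻; ∈-upTo⁻)
open import Data.List.Relation.Unary.Any using (here; there)
open import Data.Product using (_×_; _,_)
open import Data.Sum using (inj₁; inj₂)
open import Relation.Nullary using (yes; no; contradiction)
open import Relation.Binary.PropositionalEquality as ≡ using (_≡_)

module _ where
  open +-*-Solver

  n-[n+k]-1≡-[1+k] : ∀ n k → + n - + (n ℕ.+ k) - + 1 ≡ -[1+ k ]
  n-[n+k]-1≡-[1+k] n k rewrite pos-+ n k =
    solve 2 (λ n k → n :- (n :+ k) :- con (+ 1) := :- (con (+ 1) :+ k)) ≡.refl (+ n) (+ k)

  [1+f+k]-f-1≡k : ∀ f k → + (suc f ℕ.+ k) - + f - + 1 ≡ + k
  [1+f+k]-f-1≡k f k rewrite pos-+ (suc f) k =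
    solve 2 (λ f k → (con (+ 1) :+ f) :+ k :- f :- con (+ 1) := k) ≡.refl (+ f) (+ k)

  [1+n+k]+1-[1+t+n]≡1+k-t : ∀ n k t → + suc (n ℕ.+ k) ℤ.+ + 1 - + (suc t ℕ.+ n) ≡ + suc k - + t
  [1+n+k]+1-[1+t+n]≡1+k-t n k t rewrite pos-+ n k | pos-+ t n =
    solve 3 (λ n k t → (con (+ 1) :+ (n :+ k)) :+ con (+ 1) :- (con (+ 1) :+ (t :+ n)) := (con (+ 1) :+ k) :- t)
      ≡.refl (+ n) (+ k) (+ t)

n-f-1≡-[1+f∸n] : ∀ {n f} → n ≤ f → + n - + f - + 1 ≡ -[1+ f ∸ n ]
n-f-1≡-[1+f∸n] {n} {f} n≤f =
  ≡.trans (≡.cong (λ m → + n - + m - + 1) (≡.sym (m+[n∸m]≡n n≤f))) (n-[n+k]-1≡-[1+k] n (f ∸ n))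

n-f-1≡+[n∸1+f] : ∀ {n f} → f < n → + n - + f - + 1 ≡ + (n ∸ suc f)
n-f-1≡+[n∸1+f] {n} {f} f<n =
  ≡.trans (≡.cong (λ m → + m - + f - + 1) (≡.sym (m+[n∸m]≡n f<n))) ([1+f+k]-f-1≡k f (n ∸ suc f))

1+f+1-[1+t+n]≡1+[f∸n]-t : ∀ {n f} t → n ≤ f → + suc f ℤ.+ + 1 - + (suc t ℕ.+ n) ≡ + suc (f ∸ n) - + t
1+f+1-[1+t+n]≡1+[f∸n]-t {n} {f} t n≤f =
  ≡.trans (≡.cong (λ m → + suc m ℤ.+ + 1 - + (suc t ℕ.+ n)) (≡.sym (m+[n∸m]≡n n≤f)))
          ([1+n+k]+1-[1+t+n]≡1+k-t n (f ∸ n) t)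

rangeAbove-suc : ∀ {lo f} → lo ≤ f → rangeAbove lo (suc f) ≡ rangeAbove lo f ++ suc f ∷ []
rangeAbove-suc {lo} {f} lo≤f = begin
  map h (upTo (suc f ∸ lo))              ≡⟨ ≡.cong (λ k → map h (upTo k)) (+-∸-assoc 1 lo≤f) ⟩
  map h (upTo (suc (f ∸ lo)))            ≡⟨ ≡.cong (map h) (≡.sym (List.upTo-∷ʳ (f ∸ lo))) ⟩
  map h (upTo (f ∸ lo) ++ f ∸ lo ∷ [])   ≡⟨ List.map-++ h (upTo (f ∸ lo)) _ ⟩
  rangeAbove lo f ++ h (f ∸ lo) ∷ []     ≡⟨ ≡.cong (λ v → rangeAbove lo f ++ suc v ∷ []) (m+[n∸m]≡n lo≤f) ⟩
  rangeAbove lo f ++ suc f ∷ [] ∎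
  where
  open ≡.≡-Reasoning
  h : ℕ → ℕ
  h i = suc (lo ℕ.+ i)

∈-rangeAbove⇒≤ : ∀ {lo f v} → lo ≤ f → v ∈ rangeAbove lo f → v ≤ f
∈-rangeAbove⇒≤ {lo} lo≤f v∈ with ∈-map⁻ (λ i → suc (lo ℕ.+ i)) v∈
... | i , i∈ , ≡.refl = ℕP.≤-trans (ℕP.+-monoʳ-< lo (∈-upTo⁻ i∈)) (ℕP.≤-reflexive (m+[n∸m]≡n lo≤f))

rangeAbove-self : ∀ f → rangeAbove f f ≡ []
rangeAbove-self f = ≡.cong (λ k → map (λ i → suc (f ℕ.+ i)) (upTo k)) (n∸n≡0 f)

module _ {c ℓ : Level} (R : CommutativeRing c ℓ) where
  open CommutativeRing R
  open import Relation.Binary.Reasoning.Setoid setoid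
  open import Algebra.Properties.CommutativeSemigroup +-commutativeSemigroup using (interchange)
  open import Algebra.Properties.CommutativeSemigroup *-commutativeSemigroup using (x∙yz≈y∙xz)

  infixl 7 _⋆_
  _⋆_ : Series R → Series R → Series R
  _⋆_ = _⊛_ R

  linProd geomProd : (ℕ → Carrier) → ℕ → Series R
  linProd  = prodS R (linS R)
  geomProd = prodS R (geomS R)

  sumBelow-cong : ∀ {g h : ℕ → Carrier} n → (∀ i → i < n → g i ≈ h i) → sumBelow R g n ≈ sumBelow R h n
  sumBelow-cong zero    g≈h = refl
  sumBelow-cong (suc n) g≈h = +-cong (sumBelow-cong n (λ i i<n → g≈h i (ℕP.m<n⇒m<1+n i<n))) (g≈h n ℕP.≤-refl)

  sumBelow-zero : ∀ {g : ℕ → Carrier} n → (∀ i → i < n → g i ≈ 0#) → sumBelow R g n ≈ 0#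
  sumBelow-zero n g≈0 = trans (sumBelow-cong n g≈0) (zero≈0 n)
    where
    zero≈0 : ∀ n → sumBelow R (λ _ → 0#) n ≈ 0#
    zero≈0 zero    = refl
    zero≈0 (suc n) = trans (+-identityʳ _) (zero≈0 n)

  sumBelow-suc : ∀ (g : ℕ → Carrier) n → sumBelow R g (suc n) ≈ g 0 + sumBelow R (λ i → g (suc i)) n
  sumBelow-suc g zero    = trans (+-identityˡ _) (sym (+-identityʳ _))
  sumBelow-suc g (suc n) = trans (+-congʳ (sumBelow-suc g n)) (+-assoc _ _ _)

  sumBelow-+ : ∀ (g h : ℕ → Carrier) n → sumBelow R (λ i → g i + h i) n ≈ sumBelow R g n + sumBelow R h n
  sumBelow-+ g h zero    = sym (+-identityˡ _)
  sumBelow-+ g h (suc n) = trans (+-congʳ (sumBelow-+ g h n)) (interchange _ _ _ _)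

  sumBelow-*ˡ : ∀ a (g : ℕ → Carrier) n → sumBelow R (λ i → a * g i) n ≈ a * sumBelow R g n
  sumBelow-*ˡ a g zero    = sym (zeroʳ a)
  sumBelow-*ˡ a g (suc n) = trans (+-congʳ (sumBelow-*ˡ a g n)) (sym (distribˡ a _ _))

  ⋆-congʳ : ∀ (S : Series R) {T T′ : Series R} → (∀ m → T m ≈ T′ m) → ∀ n → (S ⋆ T) n ≈ (S ⋆ T′) n
  ⋆-congʳ S T≈T′ n = sumBelow-cong (suc n) (λ i _ → *-congˡ (T≈T′ (n ∸ i)))

  ⋆-coeff₀ : ∀ (S T : Series R) → (S ⋆ T) 0 ≈ S 0 * T 0
  ⋆-coeff₀ S T = +-identityˡ _

  ⋆-identityʳ : ∀ (S : Series R) n → (S ⋆ oneS R) n ≈ S n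
  ⋆-identityʳ S zero    = trans (+-identityˡ _) (*-identityʳ _)
  ⋆-identityʳ S (suc m) = begin
    sumBelow R (λ i → S i * oneS R (suc m ∸ i)) (suc m) + S (suc m) * oneS R (m ∸ m)
      ≈⟨ +-cong (sumBelow-zero (suc m) (λ i i≤m → trans (*-congˡ (oneS-above i≤m)) (zeroʳ _)))
                (*-congˡ (reflexive (≡.cong (oneS R) (n∸n≡0 m)))) ⟩
    0# + S (suc m) * 1#
      ≈⟨ trans (+-identityˡ _) (*-identityʳ _) ⟩
    S (suc m) ∎
    where
    oneS-above : ∀ {i} → i < suc m → oneS R (suc m ∸ i) ≈ 0#
    oneS-above (s≤s i≤m) = reflexive (≡.cong (oneS R) (+-∸-assoc 1 i≤m))

  ⋆-shiftʳ : ∀ (S T U V : Series R) a → T 0 ≈ U 0 → (∀ m → T (suc m) ≈ U (suc m) + a * V m) →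
             ∀ m → (S ⋆ T) (suc m) ≈ (S ⋆ U) (suc m) + a * (S ⋆ V) m
  ⋆-shiftʳ S T U V a T₀≈U₀ T≈U+aV m = begin
    sumBelow R (λ i → S i * T (suc m ∸ i)) (suc m) + S (suc m) * T (m ∸ m)
      ≈⟨ +-cong (sumBelow-cong (suc m) term) (*-congˡ top) ⟩
    sumBelow R (λ i → S i * U (suc m ∸ i) + a * (S i * V (m ∸ i))) (suc m) + S (suc m) * U (m ∸ m)
      ≈⟨ +-congʳ (trans (sumBelow-+ _ _ (suc m)) (+-congˡ (sumBelow-*ˡ a _ (suc m)))) ⟩
    (sumBelow R (λ i → S i * U (suc m ∸ i)) (suc m) + a * (S ⋆ V) m) + S (suc m) * U (m ∸ m)
      ≈⟨ trans (+-assoc _ _ _) (trans (+-congˡ (+-comm _ _)) (sym (+-assoc _ _ _))) ⟩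
    (S ⋆ U) (suc m) + a * (S ⋆ V) m ∎
    where
    top : T (m ∸ m) ≈ U (m ∸ m)
    top rewrite n∸n≡0 m = T₀≈U₀
    term : ∀ i → i < suc m → S i * T (suc m ∸ i) ≈ S i * U (suc m ∸ i) + a * (S i * V (m ∸ i))
    term i (s≤s i≤m) rewrite +-∸-assoc 1 i≤m =
      trans (*-congˡ (T≈U+aV (m ∸ i))) (trans (distribˡ _ _ _) (+-congˡ (x∙yz≈y∙xz _ _ _)))

  ⋆-shiftˡ : ∀ (S U V T : Series R) a → S 0 ≈ U 0 → (∀ m → S (suc m) ≈ U (suc m) + a * V m) →
             ∀ m → (S ⋆ T) (suc m) ≈ (U ⋆ T) (suc m) + a * (V ⋆ T) m
  ⋆-shiftˡ S U V T a S₀≈U₀ S≈U+aV m = begin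
    (S ⋆ T) (suc m)
      ≈⟨ sumBelow-suc _ (suc m) ⟩
    S 0 * T (suc m) + sumBelow R (λ i → S (suc i) * T (m ∸ i)) (suc m)
      ≈⟨ +-cong (*-congʳ S₀≈U₀) (sumBelow-cong (suc m) (λ i _ → term i)) ⟩
    U 0 * T (suc m) + sumBelow R (λ i → U (suc i) * T (m ∸ i) + a * (V i * T (m ∸ i))) (suc m)
      ≈⟨ +-congˡ (trans (sumBelow-+ _ _ (suc m)) (+-congˡ (sumBelow-*ˡ a _ (suc m)))) ⟩
    U 0 * T (suc m) + (sumBelow R (λ i → U (suc i) * T (m ∸ i)) (suc m) + a * (V ⋆ T) m)
      ≈⟨ trans (sym (+-assoc _ _ _)) (+-congʳ (sym (sumBelow-suc _ (suc m)))) ⟩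
    (U ⋆ T) (suc m) + a * (V ⋆ T) m ∎
    where
    term : ∀ i → S (suc i) * T (m ∸ i) ≈ U (suc i) * T (m ∸ i) + a * (V i * T (m ∸ i))
    term i = trans (*-congʳ (S≈U+aV i)) (trans (distribʳ _ _ _) (+-congˡ (*-assoc _ _ _)))

  ⋆-linS : ∀ (S : Series R) a m → (S ⋆ linS R a) (suc m) ≈ S (suc m) + a * S m
  ⋆-linS S a m = trans (⋆-shiftʳ S (linS R a) (oneS R) (oneS R) a refl linS≈1+au m)
                       (+-cong (⋆-identityʳ S (suc m)) (*-congˡ (⋆-identityʳ S m)))
    where
    linS≈1+au : ∀ m → linS R a (suc m) ≈ oneS R (suc m) + a * oneS R m
    linS≈1+au zero    = sym (trans (+-identityˡ _) (*-identityʳ _))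
    linS≈1+au (suc m) = sym (trans (+-identityˡ _) (zeroʳ _))

  ⋆-geomS : ∀ (S : Series R) a m → (S ⋆ geomS R a) (suc m) ≈ S (suc m) + a * (S ⋆ geomS R a) m
  ⋆-geomS S a m = trans (⋆-shiftʳ S (geomS R a) (oneS R) (geomS R a) a refl (λ _ → sym (+-identityˡ _)) m)
                        (+-congʳ (⋆-identityʳ S (suc m)))

  prodS-coeff₀ : ∀ (F : Carrier → Series R) y → (∀ a → F a 0 ≈ 1#) → ∀ k → prodS R F y k 0 ≈ 1#
  prodS-coeff₀ F y F₀≈1 zero    = refl
  prodS-coeff₀ F y F₀≈1 (suc k) =
    trans (⋆-coeff₀ (prodS R F y k) (F (y (suc k)))) (trans (*-cong (prodS-coeff₀ F y F₀≈1 k) (F₀≈1 _)) (*-identityʳ 1#))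

  ⋆-linS-geomS : ∀ (S T : Series R) a e m →
    ((S ⋆ linS R a) ⋆ (T ⋆ geomS R e)) (suc m) ≈ (S ⋆ T) (suc m) + (a + e) * (S ⋆ (T ⋆ geomS R e)) m
  ⋆-linS-geomS S T a e m = begin
    ((S ⋆ linS R a) ⋆ G) (suc m)
      ≈⟨ ⋆-shiftˡ (S ⋆ linS R a) S S G a (trans (⋆-coeff₀ S (linS R a)) (*-identityʳ _)) (⋆-linS S a) m ⟩
    (S ⋆ G) (suc m) + a * (S ⋆ G) m
      ≈⟨ +-congʳ (⋆-shiftʳ S G T G e (trans (⋆-coeff₀ T (geomS R e)) (*-identityʳ _)) (⋆-geomS T e) m) ⟩
    ((S ⋆ T) (suc m) + e * (S ⋆ G) m) + a * (S ⋆ G) m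
      ≈⟨ trans (+-assoc _ _ _) (+-congˡ (trans (+-comm _ _) (sym (distribʳ _ a e)))) ⟩
    (S ⋆ T) (suc m) + (a + e) * (S ⋆ G) m ∎
    where
    G : Series R
    G = T ⋆ geomS R e

  Degree≤ : Series R → ℕ → Set ℓ
  Degree≤ S d = ∀ m → d < m → S m ≈ 0#

  linProd-degree≤ : ∀ y k → Degree≤ (linProd y k) k
  linProd-degree≤ y zero    (suc m) _         = refl
  linProd-degree≤ y (suc k) (suc m) (s≤s k<m) = begin
    (linProd y k ⋆ linS R (y (suc k))) (suc m) ≈⟨ ⋆-linS (linProd y k) (y (suc k)) m ⟩
    linProd y k (suc m) + y (suc k) * linProd y k m
      ≈⟨ +-cong (linProd-degree≤ y k (suc m) (ℕP.m<n⇒m<1+n k<m)) (*-congˡ (linProd-degree≤ y k m k<m)) ⟩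
    0# + y (suc k) * 0# ≈⟨ trans (+-identityˡ _) (zeroʳ _) ⟩
    0# ∎

  ⋆-degree≤ : ∀ {S T : Series R} {p q} → Degree≤ S p → Degree≤ T q → Degree≤ (S ⋆ T) (p ℕ.+ q)
  ⋆-degree≤ {S} {T} {p} {q} degS degT n p+q<n = sumBelow-zero (suc n) term
    where
    term : ∀ i → i < suc n → S i * T (n ∸ i) ≈ 0#
    term i _ with i ≤? p
    ... | yes i≤p = trans (*-congˡ (degT (n ∸ i) q<n∸i)) (zeroʳ _)
      where
      q<n∸i : q < n ∸ i
      q<n∸i = ℕP.m+n≤o⇒m≤o∸n (suc q) (ℕP.≤-trans (ℕP.+-monoʳ-≤ (suc q) i≤p)
                (ℕP.≤-trans (ℕP.≤-reflexive (≡.cong suc (ℕP.+-comm q p))) p+q<n))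
    ... | no i≰p = trans (*-congʳ (degS i (ℕP.≰⇒> i≰p))) (zeroˡ _)

  sumL-++ : ∀ {A : Set} (F : A → Carrier) xs ys → sumL R (map F (xs ++ ys)) ≈ sumL R (map F xs) + sumL R (map F ys)
  sumL-++ F []       ys = sym (+-identityˡ _)
  sumL-++ F (x ∷ xs) ys = trans (+-congˡ (sumL-++ F xs ys)) (sym (+-assoc _ _ _))

  sumL-cong : ∀ {A : Set} {F G : A → Carrier} xs → (∀ x → x ∈ xs → F x ≈ G x) → sumL R (map F xs) ≈ sumL R (map G xs)
  sumL-cong []       F≈G = refl
  sumL-cong (x ∷ xs) F≈G = +-cong (F≈G x (here ≡.refl)) (sumL-cong xs (λ y y∈xs → F≈G y (there y∈xs)))

  sumL-+ : ∀ {A : Set} (F G : A → Carrier) xs →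
           sumL R (map (λ x → F x + G x) xs) ≈ sumL R (map F xs) + sumL R (map G xs)
  sumL-+ F G []       = sym (+-identityˡ _)
  sumL-+ F G (x ∷ xs) = trans (+-congˡ (sumL-+ F G xs)) (interchange _ _ _ _)

  sumL-*ˡ : ∀ {A : Set} a (F : A → Carrier) xs → sumL R (map (λ x → a * F x) xs) ≈ a * sumL R (map F xs)
  sumL-*ˡ a F []       = sym (zeroʳ a)
  sumL-*ˡ a F (x ∷ xs) = trans (+-congˡ (sumL-*ˡ a F xs)) (sym (distribˡ a _ _))

  sumL-concatMap : ∀ (F : List ℕ → Carrier) (g : ℕ → List (List ℕ)) xs →
    sumL R (map F (concatMap (λ v → map (v ∷_) (g v)) xs))
      ≈ sumL R (map (λ v → sumL R (map (λ vs → F (v ∷ vs)) (g v))) xs)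
  sumL-concatMap F g []       = refl
  sumL-concatMap F g (x ∷ xs) =
    trans (sumL-++ F (map (x ∷_) (g x)) _)
          (+-cong (reflexive (≡.cong (sumL R) (≡.sym (List.map-∘ (g x))))) (sumL-concatMap F g xs))

  module _ (z : ℕ → Carrier) (b : ℤ → Carrier) where

    boxWeight : ℕ → ℕ → Carrier
    boxWeight col v = z v + b (+ v ℤ.+ + 1 ℤ.- + col)

    fillingSum : ℕ → ℕ → ℕ → ℕ → Carrier
    fillingSum lo col f n = sumL R (map (fillWeight R z b col) (incSeqs n lo f))

    fillingSum-suc : ∀ lo col f n → fillingSum lo col f (suc n)
      ≈ sumL R (map (λ v → boxWeight col v * fillingSum v (suc col) f n) (rangeAbove lo f))
    fillingSum-suc lo col f n =
      trans (sumL-concatMap (fillWeight R z b col) (λ v → incSeqs n v f) (rangeAbove lo f))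
            (sumL-cong (rangeAbove lo f) (λ v _ → sumL-*ˡ (boxWeight col v) (fillWeight R z b (suc col)) (incSeqs n v f)))

    fillingSum-self : ∀ f col n → fillingSum f col f (suc n) ≈ 0#
    fillingSum-self f col n = trans (fillingSum-suc f col f n)
      (reflexive (≡.cong (λ xs → sumL R (map (λ v → boxWeight col v * fillingSum v (suc col) f n) xs)) (rangeAbove-self f)))

    fillingSum-split : ∀ {lo f} → lo ≤ f → ∀ col n → fillingSum lo col (suc f) (suc n)
      ≈ sumL R (map (λ v → boxWeight col v * fillingSum v (suc col) (suc f) n) (rangeAbove lo f))
        + boxWeight col (suc f) * fillingSum (suc f) (suc col) (suc f) n
    fillingSum-split {lo} {f} lo≤f col n = begin
      fillingSum lo col (suc f) (suc n)              ≈⟨ fillingSum-suc lo col (suc f) n ⟩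
      sumL R (map G (rangeAbove lo (suc f)))         ≡⟨ ≡.cong (λ xs → sumL R (map G xs)) (rangeAbove-suc lo≤f) ⟩
      sumL R (map G (rangeAbove lo f ++ suc f ∷ [])) ≈⟨ sumL-++ G (rangeAbove lo f) (suc f ∷ []) ⟩
      sumL R (map G (rangeAbove lo f)) + (G (suc f) + 0#) ≈⟨ +-congˡ (+-identityʳ _) ⟩
      sumL R (map G (rangeAbove lo f)) + G (suc f) ∎
      where
      G : ℕ → Carrier
      G v = boxWeight col v * fillingSum v (suc col) (suc f) n

    -- the last box, at column col + n, either holds an entry ≤ f or holds f + 1
    fillingSum-recurrence : ∀ {lo f} → lo ≤ f → ∀ col n → fillingSum lo col (suc f) (suc n)
      ≈ fillingSum lo col f (suc n) + boxWeight (col ℕ.+ n) (suc f) * fillingSum lo col f n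
    fillingSum-recurrence {lo} {f} lo≤f col zero =
      trans (fillingSum-split lo≤f col 0)
            (+-cong (sym (fillingSum-suc lo col f 0))
                    (*-congʳ (reflexive (≡.cong (λ k → boxWeight k (suc f)) (≡.sym (ℕP.+-identityʳ col))))))
    fillingSum-recurrence {lo} {f} lo≤f col (suc m) = begin
      fillingSum lo col (suc f) (suc (suc m))
        ≈⟨ fillingSum-split lo≤f col (suc m) ⟩
      Σ (λ v → boxWeight col v * fillingSum v (suc col) (suc f) (suc m))
        + boxWeight col (suc f) * fillingSum (suc f) (suc col) (suc f) (suc m)
        ≈⟨ +-cong (sumL-cong (rangeAbove lo f) (λ v v∈ →
                    *-congˡ (fillingSum-recurrence (∈-rangeAbove⇒≤ lo≤f v∈) (suc col) m)))
                  (trans (*-congˡ (fillingSum-self (suc f) (suc col) m)) (zeroʳ _)) ⟩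
      Σ (λ v → boxWeight col v * (next (suc m) v + lastBox * next m v)) + 0#
        ≈⟨ trans (+-identityʳ _) (sumL-cong (rangeAbove lo f) (λ _ _ →
                   trans (distribˡ _ _ _) (+-congˡ (x∙yz≈y∙xz _ _ _)))) ⟩
      Σ (λ v → boxWeight col v * next (suc m) v + lastBox * (boxWeight col v * next m v))
        ≈⟨ trans (sumL-+ _ _ (rangeAbove lo f)) (+-congˡ (sumL-*ˡ lastBox _ (rangeAbove lo f))) ⟩
      Σ (λ v → boxWeight col v * next (suc m) v) + lastBox * Σ (λ v → boxWeight col v * next m v)
        ≈⟨ +-cong (sym (fillingSum-suc lo col f (suc m)))
                  (*-cong (reflexive (≡.cong (λ k → boxWeight k (suc f)) (≡.sym (ℕP.+-suc col m))))
                          (sym (fillingSum-suc lo col f m))) ⟩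
      fillingSum lo col f (suc (suc m)) + boxWeight (col ℕ.+ suc m) (suc f) * fillingSum lo col f (suc m) ∎
      where
      Σ : (ℕ → Carrier) → Carrier
      Σ G = sumL R (map G (rangeAbove lo f))
      next : ℕ → ℕ → Carrier
      next k v = fillingSum v (suc col) f k
      lastBox : Carrier
      lastBox = boxWeight (suc col ℕ.+ m) (suc f)

    fillingSum-empty : ∀ col {f n} → f < n → fillingSum 0 col f n ≈ 0#
    fillingSum-empty col {zero}  {suc n} _           = refl
    fillingSum-empty col {suc f} {suc n} (s≤s f<n) = begin
      fillingSum 0 col (suc f) (suc n)  ≈⟨ fillingSum-recurrence z≤n col n ⟩
      fillingSum 0 col f (suc n) + boxWeight (col ℕ.+ n) (suc f) * fillingSum 0 col f n
        ≈⟨ +-cong (fillingSum-empty col (ℕP.m<n⇒m<1+n f<n)) (*-congˡ (fillingSum-empty col f<n)) ⟩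
      0# + boxWeight (col ℕ.+ n) (suc f) * 0# ≈⟨ trans (+-identityˡ _) (zeroʳ _) ⟩
      0# ∎

    module _ (t : ℕ) where
      private
        y : ℕ → Carrier
        y = shiftSeq R b t

      fillingSum≈coeff : ∀ f n → n ≤ suc f →
        fillingSum 0 (suc t) f n ≈ (linProd z f ⋆ geomProd y (suc f ∸ n)) n
      fillingSum≈coeff f n n≤1+f with ℕP.m≤n⇒m<n∨m≡n n≤1+f
      ... | inj₂ ≡.refl = trans (fillingSum-empty (suc t) {f} ℕP.≤-refl) (sym topCoeff)
        where
        topCoeff : (linProd z f ⋆ geomProd y (f ∸ f)) (suc f) ≈ 0#
        topCoeff = begin
          (linProd z f ⋆ geomProd y (f ∸ f)) (suc f)
            ≈⟨ ⋆-congʳ (linProd z f) (λ m → reflexive (≡.cong (λ k → geomProd y k m) (n∸n≡0 f))) (suc f) ⟩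
          (linProd z f ⋆ oneS R) (suc f) ≈⟨ ⋆-identityʳ (linProd z f) (suc f) ⟩
          linProd z f (suc f)          ≈⟨ linProd-degree≤ z f (suc f) ℕP.≤-refl ⟩
          0# ∎
      fillingSum≈coeff f zero _ | inj₁ _ = begin
        1# + 0#                                  ≈⟨ +-identityʳ 1# ⟩
        1#                                       ≈⟨ sym (*-identityʳ 1#) ⟩
        1# * 1#                                  ≈⟨ sym (*-cong (prodS-coeff₀ (linS R) z (λ _ → refl) f)
                                                               (prodS-coeff₀ (geomS R) y (λ _ → refl) (suc f))) ⟩
        linProd z f 0 * geomProd y (suc f) 0     ≈⟨ sym (⋆-coeff₀ (linProd z f) (geomProd y (suc f))) ⟩
        (linProd z f ⋆ geomProd y (suc f)) 0 ∎
      fillingSum≈coeff zero    (suc n) _ | inj₁ (s≤s ())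
      fillingSum≈coeff (suc f) (suc n) _ | inj₁ (s≤s (s≤s n≤f)) = begin
        fillingSum 0 (suc t) (suc f) (suc n)
          ≈⟨ fillingSum-recurrence z≤n (suc t) n ⟩
        fillingSum 0 (suc t) f (suc n) + boxWeight (suc t ℕ.+ n) (suc f) * fillingSum 0 (suc t) f n
          ≈⟨ +-cong (fillingSum≈coeff f (suc n) (s≤s n≤f))
                    (*-cong (+-congˡ (reflexive (≡.cong b (1+f+1-[1+t+n]≡1+[f∸n]-t t n≤f))))
                            (fillingSum≈coeff f n (ℕP.m≤n⇒m≤1+n n≤f))) ⟩
        (S ⋆ geomProd y (f ∸ n)) (suc n) + w * (S ⋆ geomProd y (suc f ∸ n)) n
          ≡⟨ ≡.cong (λ k → (S ⋆ geomProd y (f ∸ n)) (suc n) + w * (S ⋆ geomProd y k) n) (+-∸-assoc 1 n≤f) ⟩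
        (S ⋆ geomProd y (f ∸ n)) (suc n) + w * (S ⋆ geomProd y (suc (f ∸ n))) n
          ≈⟨ sym (⋆-linS-geomS S (geomProd y (f ∸ n)) (z (suc f)) (y (suc (f ∸ n))) n) ⟩
        (linProd z (suc f) ⋆ geomProd y (suc (f ∸ n))) (suc n)
          ≡⟨ ≡.cong (λ k → (linProd z (suc f) ⋆ geomProd y k) (suc n)) (≡.sym (+-∸-assoc 1 n≤f)) ⟩
        (linProd z (suc f) ⋆ geomProd y (suc f ∸ n)) (suc n) ∎
        where
        S : Series R
        S = linProd z f
        w : Carrier
        w = z (suc f) + y (suc (f ∸ n))

  eKL-≤ : ∀ z y {n f} → n ≤ f →
          eKL R (+ f) (+ n ℤ.- + f ℤ.- + 1) z y n ≡ (linProd z f ⋆ geomProd y (suc f ∸ n)) n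
  eKL-≤ z y {n} {f} n≤f =
    ≡.trans (≡.cong (λ e → (linProd z f ⋆ eGen R e y) n) (n-f-1≡-[1+f∸n] n≤f))
            (≡.cong (λ k → (linProd z f ⋆ geomProd y k) n) (≡.sym (+-∸-assoc 1 n≤f)))

  eKL-> : ∀ z y {n f} → f < n →
          eKL R (+ f) (+ n ℤ.- + f ℤ.- + 1) z y n ≡ (linProd z f ⋆ linProd y (n ∸ suc f)) n
  eKL-> z y {n} {f} f<n = ≡.cong (λ e → (linProd z f ⋆ eGen R e y) n) (n-f-1≡+[n∸1+f] f<n)

  eKL-vanishes : ∀ z y {n f} → f < n → eKL R (+ f) (+ n ℤ.- + f ℤ.- + 1) z y n ≈ 0#
  eKL-vanishes z y {n} {f} f<n =
    trans (reflexive (eKL-> z y f<n))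
          (⋆-degree≤ (linProd-degree≤ z f) (linProd-degree≤ y (n ∸ suc f)) n (ℕP.≤-reflexive (m+[n∸m]≡n f<n)))

lemma3p11 : ∀ {c ℓ : Level} (R : CommutativeRing c ℓ)
    (z : ℕ → CommutativeRing.Carrier R) (b : ℤ → CommutativeRing.Carrier R)
    (r t f : ℕ) → t ≤ r →
    CommutativeRing._≈_ R (stilde R z b r t f)
      (eKL R (+ f) ((+ (r ∸ t)) - (+ f) - (+ 1)) z (shiftSeq R b t) (r ∸ t))
    × (f < r ∸ t →
       CommutativeRing._≈_ R (stilde R z b r t f) (CommutativeRing.0# R)
       × CommutativeRing._≈_ R
           (eKL R (+ f) ((+ (r ∸ t)) - (+ f) - (+ 1)) z (shiftSeq R b t) (r ∸ t))
           (CommutativeRing.0# R))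
lemma3p11 R z b r t f _ with r ∸ t ≤? f
... | yes n≤f = agree , λ f<n → contradiction n≤f (ℕP.<⇒≱ f<n)
  where
  open CommutativeRing R using (_≈_; 0#; trans; sym; reflexive)
  agree : stilde R z b r t f ≈ eKL R (+ f) (+ (r ∸ t) - + f - + 1) z (shiftSeq R b t) (r ∸ t)
  agree = trans (fillingSum≈coeff R z b t f (r ∸ t) (ℕP.m≤n⇒m≤1+n n≤f))
                (reflexive (≡.sym (eKL-≤ R z (shiftSeq R b t) n≤f)))
... | no n≰f = trans noFilling (sym rhs≈0) , λ _ → noFilling , rhs≈0
  where
  open CommutativeRing R using (_≈_; 0#; trans; sym; reflexive)
  f<n : f < r ∸ t
  f<n = ℕP.≰⇒> n≰f
  noFilling : stilde R z b r t f ≈ 0#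
  noFilling = fillingSum-empty R z b (suc t) f<n
  rhs≈0 : eKL R (+ f) (+ (r ∸ t) - + f - + 1) z (shiftSeq R b t) (r ∸ t) ≈ 0#
  rhs≈0 = eKL-vanishes R z (shiftSeq R b t) f<n
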